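{- Let $\mathbb{F}_q$ be a finite field, $P,Q\in\mathbb{F}_q[X]\setminus\{0\}$ coprime with $\deg P>\deg Q$, $\mathcal{D}=\{s\in\mathbb{F}_q[X]:\deg s<\deg P\}$, and $\mathcal{L}_{P/Q}=\{\langle w\rangle_{P/Q}:w\in\mathbb{F}_q[X]\}$. Then the map $\mathcal{L}_{P/Q}\to\mathcal{L}_{P/Q}$, $\langle w\rangle_{P/Q}\mapsto\langle Xw\rangle_{P/Q}$, is realizable by a letter-to-letter finite state transducer.
   Context: For $w\in\mathbb{F}_q[X]$ put $w_0=w$, and for $i\ge0$ let $s_i\in\mathcal{D}$ be the remainder of $Qw_i$ upon division by $P$ and $w_{i+1}=(Qw_i-s_i)/P$; with $k\ge0$ minimal such that $w_i=0$ for $i>k$, the digit string is $\langle w\rangle_{P/Q}=s_k\cdots s_0$ and $w=\sum_{i=0}^k\frac{s_i}{Q}(P/Q)^i$. A letter-to-letter finite state transducer with input and output alphabet $\mathcal{D}$ consists of a finite state set $\mathcal{Q}$, an initial state $u_0$, a transition function $q:\mathcal{Q}\times\mathcal{D}\to\mathcal{Q}$, a result function $\delta:\mathcal{Q}\times\mathcal{D}\to\mathcal{D}$ and a final output function $\delta_\varepsilon:\mathcal{Q}\to\mathcal{D}$. On input $s_k\cdots s_0$ it reads from right to left: $u_{i+1}=q(u_i,s_i)$, $d_i=\delta(u_i,s_i)$ for $0\le i\le k$, and its output is the word $\delta_\varepsilon(u_{k+1})d_kd_{k-1}\cdots d_0$. It realizes the map if for every $w$ its output on $\langle w\rangle_{P/Q}$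 is $\langle Xw\rangle_{P/Q}$, where words differing only by leading zero digits are identified. -}

module Defs where

open import Level using (0ℓ)
open import Data.Nat using (ℕ; zero; suc; _<_; _≤_)
open import Data.Fin using (Fin)
import Data.Fin.Properties as FinP
open import Data.Bool using (Bool; true; false; not; T)
open import Data.List using (List; []; _∷_; map; reverse; upTo; dropWhile; length)
open import Data.Product using (Σ; Σ-syntax; ∃-syntax; _×_; _,_; proj₁; proj₂)
open import Data.Unit using (tt)
open import Relation.Nullary using (¬_; Dec; yes; no; does)
open import Relation.Binary.PropositionalEquality
  using (_≡_; _≢_; refl; sym; trans; cong)
open import Relation.Binary.Definitions using (DecidableEquality)
open import Algebra.Structures using (IsCommutativeRing)
open import Function.Bundles using (_↔_; Inverse)

record FiniteField : Set₁ where
  field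
    F     : Set
    _+_   : F → F → F
    _*_   : F → F → F
    -_    : F → F
    0#    : F
    1#    : F
    isCommutativeRing : IsCommutativeRing _≡_ _+_ _*_ -_ 0# 1#
    0≢1   : 0# ≢ 1#
    inv   : ∀ x → x ≢ 0# → Σ[ y ∈ F ] (x * y ≡ 1#)
    q     : ℕ
    enum  : Fin q ↔ F

  _≟_ : DecidableEquality F
  x ≟ y with Inverse.from enum x FinP.≟ Inverse.from enum y
  ... | yes e = yes (trans (sym (Inverse.strictlyInverseˡ enum x))
                     (trans (cong (Inverse.to enum) e) (Inverse.strictlyInverseˡ enum y)))
  ... | no ne = no (λ e → ne (cong (Inverse.from enum) e))

module PolyOver (K : FiniteField) where
  open FiniteField K using (F; 0#; 1#; _≟_)
  private
    module K = FiniteField K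

  isZero : F → Bool
  isZero a = does (a ≟ 0#)

  -- a coefficient list (constant term first) is normalized iff it has
  -- no trailing zero coefficient
  normal? : List F → Bool
  normal? []           = true
  normal? (a ∷ [])     = not (isZero a)
  normal? (a ∷ b ∷ cs) = normal? (b ∷ cs)

  -- F_q[X]: normalized coefficient lists (so ≡ is equality of polynomials)
  Poly : Set
  Poly = Σ (List F) (λ cs → T (normal? cs))

  coeffs : Poly → List F
  coeffs = proj₁

  zeroOr : F → Bool → List F
  zeroOr a true  = []
  zeroOr a false = a ∷ []

  consS : F → List F → List F
  consS a []       = zeroOr a (isZero a)
  consS a (b ∷ bs) = a ∷ b ∷ bs

  strip : List F → List F
  strip []       = []
  strip (a ∷ cs) = consS a (strip cs)

  private
    zeroOr-normal : ∀ a → T (normal? (zeroOr a (isZero a)))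
    zeroOr-normal a with isZero a in eq
    ... | true  = tt
    ... | false rewrite eq = tt

    consS-normal : ∀ a cs → T (normal? cs) → T (normal? (consS a cs))
    consS-normal a []       _ = zeroOr-normal a
    consS-normal a (b ∷ bs) p = p

    strip-normal : ∀ cs → T (normal? (strip cs))
    strip-normal []       = tt
    strip-normal (a ∷ cs) = consS-normal a (strip cs) (strip-normal cs)

  normalize : List F → Poly
  normalize cs = strip cs , strip-normal cs

  addL : List F → List F → List F
  addL [] ys = ys
  addL (x ∷ xs) [] = x ∷ xs
  addL (x ∷ xs) (y ∷ ys) = (x K.+ y) ∷ addL xs ys

  scaleL : F → List F → List F
  scaleL a = map (a K.*_)

  mulL : List F → List F → List F
  mulL [] ys = []
  mulL (x ∷ xs) ys = addL (scaleL x ys) (0# ∷ mulL xs ys)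

  0ₚ : Poly
  0ₚ = normalize []

  1ₚ : Poly
  1ₚ = normalize (1# ∷ [])

  Xₚ : Poly
  Xₚ = normalize (0# ∷ 1# ∷ [])

  infixl 6 _+ₚ_
  infixl 7 _*ₚ_

  _+ₚ_ : Poly → Poly → Poly
  p +ₚ r = normalize (addL (coeffs p) (coeffs r))

  _*ₚ_ : Poly → Poly → Poly
  p *ₚ r = normalize (mulL (coeffs p) (coeffs r))

  -- size p = deg p + 1, with size 0 = 0 (convention deg 0 = -∞);
  -- hence  deg a < deg b  ⇔  size a < size b.
  size : Poly → ℕ
  size p = length (coeffs p)

  _∣ₚ_ : Poly → Poly → Set
  d ∣ₚ p = Σ[ c ∈ Poly ] (d *ₚ c ≡ p)

  IsUnit : Poly → Set
  IsUnit u = Σ[ v ∈ Poly ] (u *ₚ v ≡ 1ₚ)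

  Coprime : Poly → Poly → Set
  Coprime p r = ∀ d → d ∣ₚ p → d ∣ₚ r → IsUnit d

  module Base (P Q : Poly) where

    Digit : Set
    Digit = Σ[ s ∈ Poly ] (size s < size P)

    0d? : Digit → Bool
    0d? (s , _) with coeffs s
    ... | []    = true
    ... | _ ∷ _ = false

    -- words over 𝒟, written as in the paper: leftmost = most significant
    Word : Set
    Word = List Digit

    IsExpansion : Poly → (ℕ → Poly) → (ℕ → Digit) → Set
    IsExpansion w ws s =
      (ws 0 ≡ w) × (∀ i → Q *ₚ ws i ≡ P *ₚ ws (suc i) +ₚ proj₁ (s i))

    MinimalLength : (ℕ → Poly) → ℕ → Set
    MinimalLength ws k =
      (∀ i → k < i → ws i ≡ 0ₚ) ×
      (∀ j → (∀ i → j < i → ws i ≡ 0ₚ) → k ≤ j)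

    digitWord : (ℕ → Digit) → ℕ → Word
    digitWord s k = map s (reverse (upTo (suc k)))

    -- ⟨ w ⟩_{P/Q} ≡ ws  (relational form of the digit string)
    IsDigitString : Poly → Word → Set
    IsDigitString w word =
      Σ[ ws ∈ (ℕ → Poly) ] Σ[ s ∈ (ℕ → Digit) ] Σ[ k ∈ ℕ ]
        (IsExpansion w ws s × MinimalLength ws k × (word ≡ digitWord s k))

    -- identify words differing only by leading zero digits
    stripLeadingZeros : Word → Word
    stripLeadingZeros [] = []
    stripLeadingZeros (d ∷ ds) with 0d? d
    ... | true  = stripLeadingZeros ds
    ... | false = d ∷ ds

    record Transducer : Set where
      field
        n      : ℕ
        u₀     : Fin n
        step   : Fin n → Digit → Fin n
        result : Fin n → Digit → Digit
        final  : Fin n → Digit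

      -- reads a word given least significant digit first; returns the
      -- final state u_{k+1} and d_0, …, d_k
      runRev : Fin n → List Digit → Fin n × List Digit
      runRev u [] = u , []
      runRev u (s ∷ ss) with runRev (step u s) ss
      ... | u' , ds = u' , (result u s ∷ ds)

      -- output on s_k ⋯ s_0 :  δ_ε(u_{k+1}) d_k ⋯ d_0
      output : Word → Word
      output word with runRev u₀ (reverse word)
      ... | u' , ds = final u' ∷ reverse ds

    Realizes : Transducer → Set
    Realizes T = ∀ w word word' →
      IsDigitString w word → IsDigitString (Xₚ *ₚ w) word' →
      stripLeadingZeros (Transducer.output T word) ≡ stripLeadingZeros word'

module Submission where

-- Let deg P = m and let w have the expansion Q·wᵢ = P·wᵢ₊₁ + sᵢ.  Reading
-- the digits from the least significant end we keep a carry cᵢ ∈ 𝔽_q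
-- (c₀ = 0): since deg (X·sᵢ + Q·cᵢ) ≤ m, dividing by P gives a constant
-- quotient, X·sᵢ + Q·cᵢ = P·cᵢ₊₁ + tᵢ with tᵢ ∈ 𝒟.  Then vᵢ = X·wᵢ + cᵢ
-- satisfies Q·vᵢ = P·vᵢ₊₁ + tᵢ, so by uniqueness of division with
-- remainder (tᵢ, vᵢ) is the expansion of X·w; it ends at most one digit
-- after that of w, the extra digit being the final output.  The finitely
-- many carries are the states of the transducer.

open import Level using (0ℓ)
open import Defs
open import Data.Nat using (ℕ; zero; suc; _<_; _≤_; z≤n; s≤s; _≤?_) renaming (_+_ to _+ℕ_)
open import Data.Nat.Properties
  using (≤-irrelevant; ≤-trans; ≤-refl; ≤-pred; ≰⇒>; m≤m+n; m≤n+m; n≤1+n; suc-injective; m≤n⇒m<n∨m≡n)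
open import Data.List using (List; []; _∷_; map; length; reverse; upTo; applyUpTo; downFrom)
open import Data.List.Properties using (reverse-map; reverse-involutive; map-upTo; map-cong; reverse-upTo)
open import Data.Bool using (T)
open import Data.Bool.Properties using (T-irrelevant)
open import Data.Sum using (_⊎_; inj₁; inj₂)
open import Data.Fin using (Fin)
open import Data.Product using (Σ; _×_; _,_; proj₁; proj₂)
open import Data.Empty using (⊥-elim)
open import Function using (_∘_)
open import Function.Bundles using (Inverse)
open import Relation.Nullary using (yes; no)
open import Relation.Binary.PropositionalEquality
open import Algebra.Bundles using (CommutativeRing)

fieldRing : FiniteField → CommutativeRing 0ℓ 0ℓ
fieldRing K = record { isCommutativeRing = FiniteField.isCommutativeRing K }

-- (1) Coefficient lists are compared through their coefficient functions;
-- the list operations of Defs are computed coefficientwise.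
module CoefficientCalculus (K : FiniteField) where
  open FiniteField K using (F; 0#; _≟_)
  open PolyOver K
  open CommutativeRing (fieldRing K)
    using (_+_; _*_; -_; +-identityˡ; +-identityʳ; zeroˡ; zeroʳ; distribʳ; *-comm; *-assoc; commutativeSemiring)
  open import Algebra.Properties.Ring (CommutativeRing.ring (fieldRing K)) using (-0#≈0#)
  open import Algebra.Solver.Ring.NaturalCoefficients.Default commutativeSemiring
    using (solve; _:=_; _:+_; _:*_)
  open ≡-Reasoning

  coeff : List F → ℕ → F
  coeff []       n       = 0#
  coeff (x ∷ xs) zero    = x
  coeff (x ∷ xs) (suc n) = coeff xs n

  hd : List F → F
  hd []      = 0#
  hd (x ∷ _) = x

  tl : List F → List F
  tl []       = []
  tl (_ ∷ xs) = xs

  coeff-hd : ∀ xs → coeff xs 0 ≡ hd xs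
  coeff-hd []       = refl
  coeff-hd (x ∷ xs) = refl

  coeff-tl : ∀ xs n → coeff xs (suc n) ≡ coeff (tl xs) n
  coeff-tl []       n = refl
  coeff-tl (x ∷ xs) n = refl

  infix 4 _≈ₗ_
  _≈ₗ_ : List F → List F → Set
  xs ≈ₗ ys = ∀ n → coeff xs n ≡ coeff ys n

  hd-≈ : ∀ xs ys → xs ≈ₗ ys → hd xs ≡ hd ys
  hd-≈ xs ys eq = trans (sym (coeff-hd xs)) (trans (eq 0) (coeff-hd ys))

  tl-≈ : ∀ xs ys → xs ≈ₗ ys → tl xs ≈ₗ tl ys
  tl-≈ xs ys eq n = trans (sym (coeff-tl xs n)) (trans (eq (suc n)) (coeff-tl ys n))

  hd-tl : ∀ ys → hd ys ∷ tl ys ≈ₗ ys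
  hd-tl []       zero    = refl
  hd-tl []       (suc n) = refl
  hd-tl (y ∷ ys) n       = refl

  coeff-consS : ∀ a xs n → coeff (consS a xs) n ≡ coeff (a ∷ xs) n
  coeff-consS a (b ∷ bs) n = refl
  coeff-consS a [] n with a ≟ 0#
  coeff-consS a [] zero    | yes a≡0 = sym a≡0
  coeff-consS a [] (suc n) | yes _   = refl
  coeff-consS a [] n       | no _    = refl

  coeff-strip : ∀ xs → strip xs ≈ₗ xs
  coeff-strip []       n       = refl
  coeff-strip (a ∷ xs) zero    = coeff-consS a (strip xs) 0
  coeff-strip (a ∷ xs) (suc n) = trans (coeff-consS a (strip xs) (suc n)) (coeff-strip xs n)

  normal-zero : ∀ xs → T (normal? xs) → (∀ n → coeff xs n ≡ 0#) → xs ≡ []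
  normal-zero []           _    _    = refl
  normal-zero (a ∷ [])     norm vanish with a ≟ 0#
  ... | yes _   = ⊥-elim norm
  ... | no a≢0  = ⊥-elim (a≢0 (vanish 0))
  normal-zero (a ∷ b ∷ cs) norm vanish with normal-zero (b ∷ cs) norm (vanish ∘ suc)
  ... | ()

  normal-tail : ∀ a xs → T (normal? (a ∷ xs)) → T (normal? xs)
  normal-tail a []       _    = _
  normal-tail a (b ∷ cs) norm = norm

  normal-ext : ∀ xs ys → T (normal? xs) → T (normal? ys) → xs ≈ₗ ys → xs ≡ ys
  normal-ext []       ys       _  nys eq = sym (normal-zero ys nys (sym ∘ eq))
  normal-ext (x ∷ xs) []       nx _   eq = normal-zero (x ∷ xs) nx eq
  normal-ext (x ∷ xs) (y ∷ ys) nx ny  eq =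
    cong₂ _∷_ (eq 0) (normal-ext xs ys (normal-tail x xs nx) (normal-tail y ys ny) (eq ∘ suc))

  ⟦_⟧ : Poly → ℕ → F
  ⟦ p ⟧ = coeff (coeffs p)

  poly-ext : ∀ {p r} → (∀ n → ⟦ p ⟧ n ≡ ⟦ r ⟧ n) → p ≡ r
  poly-ext {xs , nxs} {ys , nys} eq with normal-ext xs ys nxs nys eq
  ... | refl = cong (xs ,_) (T-irrelevant nxs nys)


  negL : List F → List F
  negL = map -_

  coeff-add : ∀ xs ys n → coeff (addL xs ys) n ≡ coeff xs n + coeff ys n
  coeff-add []       ys       n       = sym (+-identityˡ _)
  coeff-add (x ∷ xs) []       zero    = sym (+-identityʳ _)
  coeff-add (x ∷ xs) []       (suc n) = sym (+-identityʳ _)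
  coeff-add (x ∷ xs) (y ∷ ys) zero    = refl
  coeff-add (x ∷ xs) (y ∷ ys) (suc n) = coeff-add xs ys n

  coeff-neg : ∀ xs n → coeff (negL xs) n ≡ - coeff xs n
  coeff-neg []       n       = sym -0#≈0#
  coeff-neg (x ∷ xs) zero    = refl
  coeff-neg (x ∷ xs) (suc n) = coeff-neg xs n

  coeff-scale : ∀ a xs n → coeff (scaleL a xs) n ≡ a * coeff xs n
  coeff-scale a []       n       = sym (zeroʳ a)
  coeff-scale a (x ∷ xs) zero    = refl
  coeff-scale a (x ∷ xs) (suc n) = coeff-scale a xs n

  hd-add : ∀ xs ys → hd (addL xs ys) ≡ hd xs + hd ys
  hd-add xs ys = trans (sym (coeff-hd (addL xs ys)))
    (trans (coeff-add xs ys 0) (cong₂ _+_ (coeff-hd xs) (coeff-hd ys)))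

  tl-add : ∀ xs ys → tl (addL xs ys) ≈ₗ addL (tl xs) (tl ys)
  tl-add xs ys n = begin
    coeff (tl (addL xs ys)) n           ≡⟨ sym (coeff-tl (addL xs ys) n) ⟩
    coeff (addL xs ys) (suc n)          ≡⟨ coeff-add xs ys (suc n) ⟩
    coeff xs (suc n) + coeff ys (suc n) ≡⟨ cong₂ _+_ (coeff-tl xs n) (coeff-tl ys n) ⟩
    coeff (tl xs) n + coeff (tl ys) n   ≡⟨ sym (coeff-add (tl xs) (tl ys) n) ⟩
    coeff (addL (tl xs) (tl ys)) n      ∎

  hd-scale : ∀ a xs → hd (scaleL a xs) ≡ a * hd xs
  hd-scale a []       = sym (zeroʳ a)
  hd-scale a (x ∷ xs) = refl

  tl-scale : ∀ a xs → tl (scaleL a xs) ≡ scaleL a (tl xs)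
  tl-scale a []       = refl
  tl-scale a (x ∷ xs) = refl

  mul-0 : ∀ xs ys → coeff (mulL xs ys) 0 ≡ hd xs * hd ys
  mul-0 []       ys = sym (zeroˡ _)
  mul-0 (x ∷ xs) ys = begin
    coeff (addL (scaleL x ys) (0# ∷ mulL xs ys)) 0 ≡⟨ coeff-add (scaleL x ys) _ 0 ⟩
    coeff (scaleL x ys) 0 + 0#                     ≡⟨ +-identityʳ _ ⟩
    coeff (scaleL x ys) 0                          ≡⟨ coeff-scale x ys 0 ⟩
    x * coeff ys 0                                 ≡⟨ cong (x *_) (coeff-hd ys) ⟩
    x * hd ys                                      ∎

  mul-s : ∀ xs ys n → coeff (mulL xs ys) (suc n) ≡ hd xs * coeff ys (suc n) + coeff (mulL (tl xs) ys) n
  mul-s []       ys n = sym (trans (+-identityʳ _) (zeroˡ _))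
  mul-s (x ∷ xs) ys n = trans (coeff-add (scaleL x ys) _ (suc n))
    (cong (_+ coeff (mulL xs ys) n) (coeff-scale x ys (suc n)))

  mul-congˡ : ∀ xs xs' ys → xs ≈ₗ xs' → mulL xs ys ≈ₗ mulL xs' ys
  mul-congˡ xs xs' ys eq zero = begin
    coeff (mulL xs ys) 0  ≡⟨ mul-0 xs ys ⟩
    hd xs * hd ys         ≡⟨ cong (_* hd ys) (hd-≈ xs xs' eq) ⟩
    hd xs' * hd ys        ≡⟨ sym (mul-0 xs' ys) ⟩
    coeff (mulL xs' ys) 0 ∎
  mul-congˡ xs xs' ys eq (suc n) = begin
    coeff (mulL xs ys) (suc n)                             ≡⟨ mul-s xs ys n ⟩
    hd xs * coeff ys (suc n) + coeff (mulL (tl xs) ys) n   ≡⟨ cong₂ _+_ (cong (_* coeff ys (suc n)) (hd-≈ xs xs' eq))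
                                                                 (mul-congˡ (tl xs) (tl xs') ys (tl-≈ xs xs' eq) n) ⟩
    hd xs' * coeff ys (suc n) + coeff (mulL (tl xs') ys) n ≡⟨ sym (mul-s xs' ys n) ⟩
    coeff (mulL xs' ys) (suc n)                            ∎

  mul-congʳ : ∀ xs ys ys' → ys ≈ₗ ys' → mulL xs ys ≈ₗ mulL xs ys'
  mul-congʳ xs ys ys' eq zero = begin
    coeff (mulL xs ys) 0  ≡⟨ mul-0 xs ys ⟩
    hd xs * hd ys         ≡⟨ cong (hd xs *_) (hd-≈ ys ys' eq) ⟩
    hd xs * hd ys'        ≡⟨ sym (mul-0 xs ys') ⟩
    coeff (mulL xs ys') 0 ∎
  mul-congʳ xs ys ys' eq (suc n) = begin
    coeff (mulL xs ys) (suc n)                             ≡⟨ mul-s xs ys n ⟩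
    hd xs * coeff ys (suc n) + coeff (mulL (tl xs) ys) n   ≡⟨ cong₂ _+_ (cong (hd xs *_) (eq (suc n)))
                                                                         (mul-congʳ (tl xs) ys ys' eq n) ⟩
    hd xs * coeff ys' (suc n) + coeff (mulL (tl xs) ys') n ≡⟨ sym (mul-s xs ys' n) ⟩
    coeff (mulL xs ys') (suc n)                            ∎

  mul-distribʳ : ∀ xs ys zs → mulL (addL xs ys) zs ≈ₗ addL (mulL xs zs) (mulL ys zs)
  mul-distribʳ xs ys zs zero = begin
    coeff (mulL (addL xs ys) zs) 0        ≡⟨ mul-0 (addL xs ys) zs ⟩
    hd (addL xs ys) * hd zs               ≡⟨ cong (_* hd zs) (hd-add xs ys) ⟩
    (hd xs + hd ys) * hd zs               ≡⟨ distribʳ (hd zs) (hd xs) (hd ys) ⟩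
    hd xs * hd zs + hd ys * hd zs         ≡⟨ sym (cong₂ _+_ (mul-0 xs zs) (mul-0 ys zs)) ⟩
    coeff (mulL xs zs) 0 + coeff (mulL ys zs) 0  ≡⟨ sym (coeff-add (mulL xs zs) _ 0) ⟩
    coeff (addL (mulL xs zs) (mulL ys zs)) 0 ∎
  mul-distribʳ xs ys zs (suc n) = begin
    coeff (mulL (addL xs ys) zs) (suc n)
      ≡⟨ mul-s (addL xs ys) zs n ⟩
    hd (addL xs ys) * z + coeff (mulL (tl (addL xs ys)) zs) n
      ≡⟨ cong₂ _+_ (cong (_* z) (hd-add xs ys))
                   (mul-congˡ (tl (addL xs ys)) (addL (tl xs) (tl ys)) zs (tl-add xs ys) n) ⟩
    (hd xs + hd ys) * z + coeff (mulL (addL (tl xs) (tl ys)) zs) n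
      ≡⟨ cong ((hd xs + hd ys) * z +_) (trans (mul-distribʳ (tl xs) (tl ys) zs n)
                                               (coeff-add (mulL (tl xs) zs) (mulL (tl ys) zs) n)) ⟩
    (hd xs + hd ys) * z + (coeff (mulL (tl xs) zs) n + coeff (mulL (tl ys) zs) n)
      ≡⟨ regroup (hd xs) (hd ys) z (coeff (mulL (tl xs) zs) n) (coeff (mulL (tl ys) zs) n) ⟩
    (hd xs * z + coeff (mulL (tl xs) zs) n) + (hd ys * z + coeff (mulL (tl ys) zs) n)
      ≡⟨ sym (cong₂ _+_ (mul-s xs zs n) (mul-s ys zs n)) ⟩
    coeff (mulL xs zs) (suc n) + coeff (mulL ys zs) (suc n)
      ≡⟨ sym (coeff-add (mulL xs zs) _ (suc n)) ⟩
    coeff (addL (mulL xs zs) (mulL ys zs)) (suc n) ∎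
    where
    z = coeff zs (suc n)
    regroup : ∀ a b z p q → (a + b) * z + (p + q) ≡ (a * z + p) + (b * z + q)
    regroup = solve 5 (λ a b z p q → (a :+ b) :* z :+ (p :+ q) := (a :* z :+ p) :+ (b :* z :+ q)) refl

  mul-scaleˡ : ∀ a xs ys n → coeff (mulL (scaleL a xs) ys) n ≡ a * coeff (mulL xs ys) n
  mul-scaleˡ a xs ys zero = begin
    coeff (mulL (scaleL a xs) ys) 0 ≡⟨ mul-0 (scaleL a xs) ys ⟩
    hd (scaleL a xs) * hd ys        ≡⟨ cong (_* hd ys) (hd-scale a xs) ⟩
    (a * hd xs) * hd ys             ≡⟨ *-assoc a (hd xs) (hd ys) ⟩
    a * (hd xs * hd ys)             ≡⟨ cong (a *_) (sym (mul-0 xs ys)) ⟩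
    a * coeff (mulL xs ys) 0        ∎
  mul-scaleˡ a xs ys (suc n) = begin
    coeff (mulL (scaleL a xs) ys) (suc n)
      ≡⟨ mul-s (scaleL a xs) ys n ⟩
    hd (scaleL a xs) * y + coeff (mulL (tl (scaleL a xs)) ys) n
      ≡⟨ cong₂ _+_ (cong (_* y) (hd-scale a xs)) (cong (λ l → coeff (mulL l ys) n) (tl-scale a xs)) ⟩
    (a * hd xs) * y + coeff (mulL (scaleL a (tl xs)) ys) n
      ≡⟨ cong ((a * hd xs) * y +_) (mul-scaleˡ a (tl xs) ys n) ⟩
    (a * hd xs) * y + a * coeff (mulL (tl xs) ys) n
      ≡⟨ factor a (hd xs) y (coeff (mulL (tl xs) ys) n) ⟩
    a * (hd xs * y + coeff (mulL (tl xs) ys) n)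
      ≡⟨ cong (a *_) (sym (mul-s xs ys n)) ⟩
    a * coeff (mulL xs ys) (suc n) ∎
    where
    y = coeff ys (suc n)
    factor : ∀ a x y p → (a * x) * y + a * p ≡ a * (x * y + p)
    factor = solve 4 (λ a x y p → (a :* x) :* y :+ a :* p := a :* (x :* y :+ p)) refl

  mul-consʳ : ∀ xs y ys n → coeff (mulL xs (y ∷ ys)) (suc n) ≡ y * coeff xs (suc n) + coeff (mulL xs ys) n
  mul-consʳ xs y ys zero = begin
    coeff (mulL xs (y ∷ ys)) 1
      ≡⟨ mul-s xs (y ∷ ys) 0 ⟩
    hd xs * coeff ys 0 + coeff (mulL (tl xs) (y ∷ ys)) 0
      ≡⟨ cong₂ _+_ (cong (hd xs *_) (coeff-hd ys)) (mul-0 (tl xs) (y ∷ ys)) ⟩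
    hd xs * hd ys + hd (tl xs) * y
      ≡⟨ swap (hd xs) (hd ys) (hd (tl xs)) y ⟩
    y * hd (tl xs) + hd xs * hd ys
      ≡⟨ cong₂ _+_ (cong (y *_) (sym (trans (coeff-tl xs 0) (coeff-hd (tl xs))))) (sym (mul-0 xs ys)) ⟩
    y * coeff xs 1 + coeff (mulL xs ys) 0 ∎
    where
    swap : ∀ a b c y → a * b + c * y ≡ y * c + a * b
    swap = solve 4 (λ a b c y → a :* b :+ c :* y := y :* c :+ a :* b) refl
  mul-consʳ xs y ys (suc n) = begin
    coeff (mulL xs (y ∷ ys)) (suc (suc n))
      ≡⟨ mul-s xs (y ∷ ys) (suc n) ⟩
    hd xs * coeff ys (suc n) + coeff (mulL (tl xs) (y ∷ ys)) (suc n)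
      ≡⟨ cong (hd xs * coeff ys (suc n) +_) (mul-consʳ (tl xs) y ys n) ⟩
    hd xs * coeff ys (suc n) + (y * coeff (tl xs) (suc n) + coeff (mulL (tl xs) ys) n)
      ≡⟨ swap (hd xs * coeff ys (suc n)) (y * coeff (tl xs) (suc n)) (coeff (mulL (tl xs) ys) n) ⟩
    y * coeff (tl xs) (suc n) + (hd xs * coeff ys (suc n) + coeff (mulL (tl xs) ys) n)
      ≡⟨ cong₂ _+_ (cong (y *_) (sym (coeff-tl xs (suc n)))) (sym (mul-s xs ys n)) ⟩
    y * coeff xs (suc (suc n)) + coeff (mulL xs ys) (suc n) ∎
    where
    swap : ∀ a b c → a + (b + c) ≡ b + (a + c)
    swap = solve 3 (λ a b c → a :+ (b :+ c) := b :+ (a :+ c)) refl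

  mul-comm : ∀ xs ys → mulL xs ys ≈ₗ mulL ys xs
  mul-comm xs ys zero = begin
    coeff (mulL xs ys) 0 ≡⟨ mul-0 xs ys ⟩
    hd xs * hd ys        ≡⟨ *-comm (hd xs) (hd ys) ⟩
    hd ys * hd xs        ≡⟨ sym (mul-0 ys xs) ⟩
    coeff (mulL ys xs) 0 ∎
  mul-comm xs ys (suc n) = begin
    coeff (mulL xs ys) (suc n)
      ≡⟨ mul-congʳ xs ys (hd ys ∷ tl ys) (λ i → sym (hd-tl ys i)) (suc n) ⟩
    coeff (mulL xs (hd ys ∷ tl ys)) (suc n)
      ≡⟨ mul-consʳ xs (hd ys) (tl ys) n ⟩
    hd ys * coeff xs (suc n) + coeff (mulL xs (tl ys)) n
      ≡⟨ cong (hd ys * coeff xs (suc n) +_) (mul-comm xs (tl ys) n) ⟩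
    hd ys * coeff xs (suc n) + coeff (mulL (tl ys) xs) n
      ≡⟨ sym (mul-s ys xs n) ⟩
    coeff (mulL ys xs) (suc n) ∎

  hd-mul : ∀ xs ys → hd (mulL xs ys) ≡ hd xs * hd ys
  hd-mul xs ys = trans (sym (coeff-hd (mulL xs ys))) (mul-0 xs ys)

  tl-mul : ∀ xs ys → tl (mulL xs ys) ≈ₗ addL (scaleL (hd xs) (tl ys)) (mulL (tl xs) ys)
  tl-mul xs ys n = begin
    coeff (tl (mulL xs ys)) n                                   ≡⟨ sym (coeff-tl (mulL xs ys) n) ⟩
    coeff (mulL xs ys) (suc n)                                  ≡⟨ mul-s xs ys n ⟩
    hd xs * coeff ys (suc n) + coeff (mulL (tl xs) ys) n        ≡⟨ cong (_+ coeff (mulL (tl xs) ys) n)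
                                                                      (trans (cong (hd xs *_) (coeff-tl ys n))
                                                                             (sym (coeff-scale (hd xs) (tl ys) n))) ⟩
    coeff (scaleL (hd xs) (tl ys)) n + coeff (mulL (tl xs) ys) n ≡⟨ sym (coeff-add (scaleL (hd xs) (tl ys)) _ n) ⟩
    coeff (addL (scaleL (hd xs) (tl ys)) (mulL (tl xs) ys)) n   ∎

  mul-assoc : ∀ xs ys zs → mulL (mulL xs ys) zs ≈ₗ mulL xs (mulL ys zs)
  mul-assoc xs ys zs zero = begin
    coeff (mulL (mulL xs ys) zs) 0  ≡⟨ mul-0 (mulL xs ys) zs ⟩
    hd (mulL xs ys) * hd zs         ≡⟨ cong (_* hd zs) (hd-mul xs ys) ⟩
    (hd xs * hd ys) * hd zs         ≡⟨ *-assoc (hd xs) (hd ys) (hd zs) ⟩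
    hd xs * (hd ys * hd zs)         ≡⟨ cong (hd xs *_) (sym (hd-mul ys zs)) ⟩
    hd xs * hd (mulL ys zs)         ≡⟨ sym (mul-0 xs (mulL ys zs)) ⟩
    coeff (mulL xs (mulL ys zs)) 0  ∎
  mul-assoc xs ys zs (suc n) = begin
    coeff (mulL (mulL xs ys) zs) (suc n)
      ≡⟨ mul-s (mulL xs ys) zs n ⟩
    hd (mulL xs ys) * z + coeff (mulL (tl (mulL xs ys)) zs) n
      ≡⟨ cong₂ _+_ (cong (_* z) (hd-mul xs ys))
                   (mul-congˡ (tl (mulL xs ys)) (addL (scaleL (hd xs) (tl ys)) (mulL (tl xs) ys)) zs (tl-mul xs ys) n) ⟩
    (hd xs * hd ys) * z + coeff (mulL (addL (scaleL (hd xs) (tl ys)) (mulL (tl xs) ys)) zs) n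
      ≡⟨ cong ((hd xs * hd ys) * z +_) (trans (mul-distribʳ (scaleL (hd xs) (tl ys)) (mulL (tl xs) ys) zs n)
                                              (coeff-add (mulL (scaleL (hd xs) (tl ys)) zs) _ n)) ⟩
    (hd xs * hd ys) * z + (coeff (mulL (scaleL (hd xs) (tl ys)) zs) n + coeff (mulL (mulL (tl xs) ys) zs) n)
      ≡⟨ cong ((hd xs * hd ys) * z +_) (cong₂ _+_ (mul-scaleˡ (hd xs) (tl ys) zs n) (mul-assoc (tl xs) ys zs n)) ⟩
    (hd xs * hd ys) * z + (hd xs * coeff (mulL (tl ys) zs) n + coeff (mulL (tl xs) (mulL ys zs)) n)
      ≡⟨ regroup (hd xs) (hd ys) z (coeff (mulL (tl ys) zs) n) (coeff (mulL (tl xs) (mulL ys zs)) n) ⟩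
    hd xs * (hd ys * z + coeff (mulL (tl ys) zs) n) + coeff (mulL (tl xs) (mulL ys zs)) n
      ≡⟨ cong (λ c → hd xs * c + coeff (mulL (tl xs) (mulL ys zs)) n) (sym (mul-s ys zs n)) ⟩
    hd xs * coeff (mulL ys zs) (suc n) + coeff (mulL (tl xs) (mulL ys zs)) n
      ≡⟨ sym (mul-s xs (mulL ys zs) n) ⟩
    coeff (mulL xs (mulL ys zs)) (suc n) ∎
    where
    z = coeff zs (suc n)
    regroup : ∀ a b z m r → (a * b) * z + (a * m + r) ≡ a * (b * z + m) + r
    regroup = solve 5 (λ a b z m r → (a :* b) :* z :+ (a :* m :+ r) := a :* (b :* z :+ m) :+ r) refl

  coeff-zero-const : ∀ n → coeff (0# ∷ []) n ≡ 0#
  coeff-zero-const zero    = refl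
  coeff-zero-const (suc n) = refl

  mul-const : ∀ a ys → mulL (a ∷ []) ys ≈ₗ scaleL a ys
  mul-const a ys n = begin
    coeff (addL (scaleL a ys) (0# ∷ [])) n  ≡⟨ coeff-add (scaleL a ys) (0# ∷ []) n ⟩
    coeff (scaleL a ys) n + coeff (0# ∷ []) n ≡⟨ cong (coeff (scaleL a ys) n +_) (coeff-zero-const n) ⟩
    coeff (scaleL a ys) n + 0#              ≡⟨ +-identityʳ _ ⟩
    coeff (scaleL a ys) n                   ∎

-- (2) 𝔽_q[X] with the operations of Defs is a commutative ring; every law
-- is checked coefficientwise.
module PolynomialRing (K : FiniteField) where
  open FiniteField K using (F; 0#; 1#)
  open PolyOver K
  open CoefficientCalculus K
  open CommutativeRing (fieldRing K)
    using (_+_; _*_; -_; +-assoc; +-comm; +-identityˡ; -‿inverseˡ; *-identityˡ; *-comm; zeroˡ)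
  open import Algebra.Consequences.Propositional
    using (comm∧idˡ⇒id; comm∧invˡ⇒inv; comm∧distrʳ⇒distrˡ)
  open ≡-Reasoning

  infix 8 -ₚ_
  -ₚ_ : Poly → Poly
  -ₚ p = normalize (negL (coeffs p))

  Cₚ : F → Poly
  Cₚ a = normalize (a ∷ [])

  ⟦+⟧ : ∀ p r n → ⟦ p +ₚ r ⟧ n ≡ ⟦ p ⟧ n + ⟦ r ⟧ n
  ⟦+⟧ p r n = trans (coeff-strip (addL (coeffs p) (coeffs r)) n) (coeff-add (coeffs p) (coeffs r) n)

  ⟦-⟧ : ∀ p n → ⟦ -ₚ p ⟧ n ≡ - ⟦ p ⟧ n
  ⟦-⟧ p n = trans (coeff-strip (negL (coeffs p)) n) (coeff-neg (coeffs p) n)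

  ⟦*⟧ : ∀ p r → coeffs (p *ₚ r) ≈ₗ mulL (coeffs p) (coeffs r)
  ⟦*⟧ p r = coeff-strip (mulL (coeffs p) (coeffs r))

  -- the ring axioms (one-sided where commutativity gives the other side)
  +ₚ-assoc : ∀ p r u → (p +ₚ r) +ₚ u ≡ p +ₚ (r +ₚ u)
  +ₚ-assoc p r u = poly-ext λ n → begin
    ⟦ (p +ₚ r) +ₚ u ⟧ n             ≡⟨ ⟦+⟧ (p +ₚ r) u n ⟩
    ⟦ p +ₚ r ⟧ n + ⟦ u ⟧ n          ≡⟨ cong (_+ ⟦ u ⟧ n) (⟦+⟧ p r n) ⟩
    (⟦ p ⟧ n + ⟦ r ⟧ n) + ⟦ u ⟧ n   ≡⟨ +-assoc (⟦ p ⟧ n) (⟦ r ⟧ n) (⟦ u ⟧ n) ⟩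
    ⟦ p ⟧ n + (⟦ r ⟧ n + ⟦ u ⟧ n)   ≡⟨ cong (⟦ p ⟧ n +_) (sym (⟦+⟧ r u n)) ⟩
    ⟦ p ⟧ n + ⟦ r +ₚ u ⟧ n          ≡⟨ sym (⟦+⟧ p (r +ₚ u) n) ⟩
    ⟦ p +ₚ (r +ₚ u) ⟧ n             ∎

  +ₚ-comm : ∀ p r → p +ₚ r ≡ r +ₚ p
  +ₚ-comm p r = poly-ext λ n → begin
    ⟦ p +ₚ r ⟧ n          ≡⟨ ⟦+⟧ p r n ⟩
    ⟦ p ⟧ n + ⟦ r ⟧ n     ≡⟨ +-comm (⟦ p ⟧ n) (⟦ r ⟧ n) ⟩
    ⟦ r ⟧ n + ⟦ p ⟧ n     ≡⟨ sym (⟦+⟧ r p n) ⟩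
    ⟦ r +ₚ p ⟧ n          ∎

  +ₚ-identityˡ : ∀ p → 0ₚ +ₚ p ≡ p
  +ₚ-identityˡ p = poly-ext λ n → trans (⟦+⟧ 0ₚ p n) (+-identityˡ (⟦ p ⟧ n))

  -ₚ-inverseˡ : ∀ p → -ₚ p +ₚ p ≡ 0ₚ
  -ₚ-inverseˡ p = poly-ext λ n → begin
    ⟦ -ₚ p +ₚ p ⟧ n       ≡⟨ ⟦+⟧ (-ₚ p) p n ⟩
    ⟦ -ₚ p ⟧ n + ⟦ p ⟧ n  ≡⟨ cong (_+ ⟦ p ⟧ n) (⟦-⟧ p n) ⟩
    - ⟦ p ⟧ n + ⟦ p ⟧ n   ≡⟨ -‿inverseˡ (⟦ p ⟧ n) ⟩
    0#                    ∎

  *ₚ-assoc : ∀ p r u → (p *ₚ r) *ₚ u ≡ p *ₚ (r *ₚ u)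
  *ₚ-assoc p r u = poly-ext λ n → begin
    ⟦ (p *ₚ r) *ₚ u ⟧ n                  ≡⟨ ⟦*⟧ (p *ₚ r) u n ⟩
    coeff (mulL (coeffs (p *ₚ r)) U) n   ≡⟨ mul-congˡ (coeffs (p *ₚ r)) (mulL P R) U (⟦*⟧ p r) n ⟩
    coeff (mulL (mulL P R) U) n          ≡⟨ mul-assoc P R U n ⟩
    coeff (mulL P (mulL R U)) n          ≡⟨ sym (mul-congʳ P (coeffs (r *ₚ u)) (mulL R U) (⟦*⟧ r u) n) ⟩
    coeff (mulL P (coeffs (r *ₚ u))) n   ≡⟨ sym (⟦*⟧ p (r *ₚ u) n) ⟩
    ⟦ p *ₚ (r *ₚ u) ⟧ n                  ∎
    where
    P = coeffs p
    R = coeffs r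
    U = coeffs u

  *ₚ-comm : ∀ p r → p *ₚ r ≡ r *ₚ p
  *ₚ-comm p r = poly-ext λ n → begin
    ⟦ p *ₚ r ⟧ n                         ≡⟨ ⟦*⟧ p r n ⟩
    coeff (mulL (coeffs p) (coeffs r)) n ≡⟨ mul-comm (coeffs p) (coeffs r) n ⟩
    coeff (mulL (coeffs r) (coeffs p)) n ≡⟨ sym (⟦*⟧ r p n) ⟩
    ⟦ r *ₚ p ⟧ n                         ∎

  *ₚ-identityˡ : ∀ p → 1ₚ *ₚ p ≡ p
  *ₚ-identityˡ p = poly-ext λ n → begin
    ⟦ 1ₚ *ₚ p ⟧ n                            ≡⟨ ⟦*⟧ 1ₚ p n ⟩
    coeff (mulL (coeffs 1ₚ) (coeffs p)) n    ≡⟨ mul-congˡ (coeffs 1ₚ) (1# ∷ []) (coeffs p) (coeff-strip (1# ∷ [])) n ⟩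
    coeff (mulL (1# ∷ []) (coeffs p)) n      ≡⟨ mul-const 1# (coeffs p) n ⟩
    coeff (scaleL 1# (coeffs p)) n           ≡⟨ coeff-scale 1# (coeffs p) n ⟩
    1# * ⟦ p ⟧ n                             ≡⟨ *-identityˡ (⟦ p ⟧ n) ⟩
    ⟦ p ⟧ n                                  ∎

  *ₚ-distribʳ : ∀ p r u → (r +ₚ u) *ₚ p ≡ r *ₚ p +ₚ u *ₚ p
  *ₚ-distribʳ p r u = poly-ext λ n → begin
    ⟦ (r +ₚ u) *ₚ p ⟧ n                      ≡⟨ ⟦*⟧ (r +ₚ u) p n ⟩
    coeff (mulL (coeffs (r +ₚ u)) P) n       ≡⟨ mul-congˡ (coeffs (r +ₚ u)) (addL R U) P
                                                  (coeff-strip (addL R U)) n ⟩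
    coeff (mulL (addL R U) P) n              ≡⟨ mul-distribʳ R U P n ⟩
    coeff (addL (mulL R P) (mulL U P)) n     ≡⟨ coeff-add (mulL R P) (mulL U P) n ⟩
    coeff (mulL R P) n + coeff (mulL U P) n  ≡⟨ sym (cong₂ _+_ (⟦*⟧ r p n) (⟦*⟧ u p n)) ⟩
    ⟦ r *ₚ p ⟧ n + ⟦ u *ₚ p ⟧ n              ≡⟨ sym (⟦+⟧ (r *ₚ p) (u *ₚ p) n) ⟩
    ⟦ r *ₚ p +ₚ u *ₚ p ⟧ n                   ∎
    where
    P = coeffs p
    R = coeffs r
    U = coeffs u

  polyRing : CommutativeRing 0ℓ 0ℓ
  polyRing = record
    { Carrier = Poly ; _≈_ = _≡_ ; _+_ = _+ₚ_ ; _*_ = _*ₚ_ ; -_ = -ₚ_ ; 0# = 0ₚ ; 1# = 1ₚ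
    ; isCommutativeRing = record
      { isRing = record
        { +-isAbelianGroup = record
          { isGroup = record
            { isMonoid = record
              { isSemigroup = record
                { isMagma = record { isEquivalence = isEquivalence ; ∙-cong = cong₂ _+ₚ_ }
                ; assoc   = +ₚ-assoc }
              ; identity = comm∧idˡ⇒id +ₚ-comm +ₚ-identityˡ }
            ; inverse = comm∧invˡ⇒inv {_⁻¹ = -ₚ_} {e = 0ₚ} +ₚ-comm -ₚ-inverseˡ
            ; ⁻¹-cong = cong -ₚ_ }
          ; comm = +ₚ-comm }
        ; *-cong     = cong₂ _*ₚ_
        ; *-assoc    = *ₚ-assoc
        ; *-identity = comm∧idˡ⇒id *ₚ-comm {e = 1ₚ} *ₚ-identityˡ
        ; distrib    = comm∧distrʳ⇒distrˡ {_◦_ = _+ₚ_} *ₚ-comm *ₚ-distribʳ , *ₚ-distribʳ }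
      ; *-comm = *ₚ-comm } }

  ⟦X*⟧ : ∀ p n → ⟦ Xₚ *ₚ p ⟧ (suc n) ≡ ⟦ p ⟧ n
  ⟦X*⟧ p n = begin
    ⟦ Xₚ *ₚ p ⟧ (suc n)                                       ≡⟨ ⟦*⟧ Xₚ p (suc n) ⟩
    coeff (mulL (coeffs Xₚ) (coeffs p)) (suc n)               ≡⟨ mul-congˡ (coeffs Xₚ) (0# ∷ 1# ∷ []) (coeffs p)
                                                                   (coeff-strip (0# ∷ 1# ∷ [])) (suc n) ⟩
    coeff (mulL (0# ∷ 1# ∷ []) (coeffs p)) (suc n)            ≡⟨ mul-s (0# ∷ 1# ∷ []) (coeffs p) n ⟩
    0# * ⟦ p ⟧ (suc n) + coeff (mulL (1# ∷ []) (coeffs p)) n  ≡⟨ cong₂ _+_ (zeroˡ _) (mul-const 1# (coeffs p) n) ⟩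
    0# + coeff (scaleL 1# (coeffs p)) n                       ≡⟨ +-identityˡ _ ⟩
    coeff (scaleL 1# (coeffs p)) n                            ≡⟨ coeff-scale 1# (coeffs p) n ⟩
    1# * ⟦ p ⟧ n                                              ≡⟨ *-identityˡ _ ⟩
    ⟦ p ⟧ n                                                   ∎

  ⟦*C⟧ : ∀ p a n → ⟦ p *ₚ Cₚ a ⟧ n ≡ ⟦ p ⟧ n * a
  ⟦*C⟧ p a n = begin
    ⟦ p *ₚ Cₚ a ⟧ n                          ≡⟨ cong (λ r → ⟦ r ⟧ n) (*ₚ-comm p (Cₚ a)) ⟩
    ⟦ Cₚ a *ₚ p ⟧ n                          ≡⟨ ⟦*⟧ (Cₚ a) p n ⟩
    coeff (mulL (coeffs (Cₚ a)) (coeffs p)) n ≡⟨ mul-congˡ (coeffs (Cₚ a)) (a ∷ []) (coeffs p)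
                                                   (coeff-strip (a ∷ [])) n ⟩
    coeff (mulL (a ∷ []) (coeffs p)) n       ≡⟨ mul-const a (coeffs p) n ⟩
    coeff (scaleL a (coeffs p)) n            ≡⟨ coeff-scale a (coeffs p) n ⟩
    a * ⟦ p ⟧ n                              ≡⟨ *-comm a (⟦ p ⟧ n) ⟩
    ⟦ p ⟧ n * a                              ∎

  Cₚ-zero : Cₚ 0# ≡ 0ₚ
  Cₚ-zero = poly-ext λ n → trans (coeff-strip (0# ∷ []) n) (coeff-zero-const n)

-- (3) Degrees.  A polynomial "vanishes from m" when all its coefficients of
-- index ≥ m are zero, i.e. deg p < m; for normalized lists this is exactly
-- size p ≤ m, because the last coefficient is nonzero.
module Degrees (K : FiniteField) where
  open FiniteField K using (F; 0#; 1#; _≟_; inv)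
  open PolyOver K
  open CoefficientCalculus K
  open CommutativeRing (fieldRing K)
    using (_+_; _*_; +-identityˡ; +-identityʳ; zeroʳ; *-identityˡ; commutativeSemiring)
  open import Algebra.Solver.Ring.NaturalCoefficients.Default commutativeSemiring
    using (solve; _:=_; _:*_)
  open ≡-Reasoning

  VanishesFrom : ℕ → Poly → Set
  VanishesFrom m p = ∀ i → m ≤ i → ⟦ p ⟧ i ≡ 0#

  coeff-beyond : ∀ xs n → length xs ≤ n → coeff xs n ≡ 0#
  coeff-beyond []       n       _         = refl
  coeff-beyond (x ∷ xs) (suc n) (s≤s len) = coeff-beyond xs n len

  leading-nonzero : ∀ xs m → T (normal? xs) → length xs ≡ suc m → coeff xs m ≢ 0#
  leading-nonzero (a ∷ [])     zero    norm refl with a ≟ 0#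
  ... | yes _   = ⊥-elim norm
  ... | no a≢0  = a≢0
  leading-nonzero (a ∷ b ∷ cs) (suc m) norm len = leading-nonzero (b ∷ cs) m norm (suc-injective len)

  size⇒vanishes : ∀ p {m} → size p ≤ m → VanishesFrom m p
  size⇒vanishes p size≤m i m≤i = coeff-beyond (coeffs p) i (≤-trans size≤m m≤i)

  vanishes⇒size : ∀ p m → VanishesFrom m p → size p ≤ m
  vanishes⇒size p m vanish with size p in len
  ... | zero  = z≤n
  ... | suc k with suc k ≤? m
  ...   | yes k<m = k<m
  ...   | no  k≮m = ⊥-elim (leading-nonzero (coeffs p) k (proj₂ p) len (vanish k (≤-pred (≰⇒> k≮m))))

  mul-top : ∀ i j xs ys → (∀ i' → i < i' → coeff xs i' ≡ 0#) → (∀ j' → j < j' → coeff ys j' ≡ 0#) →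
            coeff (mulL xs ys) (i +ℕ j) ≡ coeff xs i * coeff ys j
  mul-top zero zero xs ys _ _ = trans (mul-0 xs ys) (sym (cong₂ _*_ (coeff-hd xs) (coeff-hd ys)))
  mul-top zero (suc j) xs ys xs-top _ = begin
    coeff (mulL xs ys) (suc j)                           ≡⟨ mul-s xs ys j ⟩
    hd xs * coeff ys (suc j) + coeff (mulL (tl xs) ys) j ≡⟨ cong (hd xs * coeff ys (suc j) +_)
                                                              (mul-congˡ (tl xs) [] ys tl-zero j) ⟩
    hd xs * coeff ys (suc j) + 0#                        ≡⟨ +-identityʳ _ ⟩
    hd xs * coeff ys (suc j)                             ≡⟨ cong (_* coeff ys (suc j)) (sym (coeff-hd xs)) ⟩
    coeff xs 0 * coeff ys (suc j)                        ∎
    where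
    tl-zero : tl xs ≈ₗ []
    tl-zero n = trans (sym (coeff-tl xs n)) (xs-top (suc n) (s≤s z≤n))
  mul-top (suc i) j xs ys xs-top ys-top = begin
    coeff (mulL xs ys) (suc (i +ℕ j))                              ≡⟨ mul-s xs ys (i +ℕ j) ⟩
    hd xs * coeff ys (suc (i +ℕ j)) + coeff (mulL (tl xs) ys) (i +ℕ j)
      ≡⟨ cong₂ _+_ (cong (hd xs *_) (ys-top (suc (i +ℕ j)) (s≤s (m≤n+m j i))))
                   (mul-top i j (tl xs) ys tl-top ys-top) ⟩
    hd xs * 0# + coeff (tl xs) i * coeff ys j                      ≡⟨ cong (_+ coeff (tl xs) i * coeff ys j) (zeroʳ _) ⟩
    0# + coeff (tl xs) i * coeff ys j                              ≡⟨ +-identityˡ _ ⟩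
    coeff (tl xs) i * coeff ys j                                   ≡⟨ cong (_* coeff ys j) (sym (coeff-tl xs i)) ⟩
    coeff xs (suc i) * coeff ys j                                  ∎
    where
    tl-top : ∀ i' → i < i' → coeff (tl xs) i' ≡ 0#
    tl-top i' i<i' = trans (sym (coeff-tl xs i')) (xs-top (suc i') (s≤s i<i'))

  no-zero-divisors : ∀ {a b} → a ≢ 0# → b ≢ 0# → a * b ≢ 0#
  no-zero-divisors {a} {b} a≢0 b≢0 ab≡0 with inv a a≢0
  ... | a⁻¹ , aa⁻¹≡1 = b≢0 (begin
    b               ≡⟨ sym (*-identityˡ b) ⟩
    1# * b          ≡⟨ cong (_* b) (sym aa⁻¹≡1) ⟩
    (a * a⁻¹) * b   ≡⟨ rearrange a a⁻¹ b ⟩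
    a⁻¹ * (a * b)   ≡⟨ cong (a⁻¹ *_) ab≡0 ⟩
    a⁻¹ * 0#        ≡⟨ zeroʳ a⁻¹ ⟩
    0#              ∎)
    where
    rearrange : ∀ a a' b → (a * a') * b ≡ a' * (a * b)
    rearrange = solve 3 (λ a a' b → (a :* a') :* b := a' :* (a :* b)) refl

-- (3, continued) Uniqueness of division with remainder by P of degree m:
-- P·a + b determines a and b when deg b < m.
module Division (K : FiniteField) (P : PolyOver.Poly K) (m : ℕ) (deg-P : PolyOver.size K P ≡ suc m) where
  open FiniteField K using (F; 0#; 1#; inv)
  open PolyOver K
  open CoefficientCalculus K
  open PolynomialRing K
  open Degrees K
  open CommutativeRing (fieldRing K) using (_+_; _*_; -_; +-identityʳ; -‿inverseʳ; *-identityˡ; *-assoc; *-comm)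
  open import Algebra.Properties.Ring (CommutativeRing.ring polyRing)
    using (x[y-z]≈xy-xz; x∙y⁻¹≈ε⇒x≈y; +-cancelˡ)
  open ≡-Reasoning

  lc : F
  lc = ⟦ P ⟧ m

  lc≢0 : lc ≢ 0#
  lc≢0 = leading-nonzero (coeffs P) m (proj₂ P) deg-P

  lc⁻¹ : F
  lc⁻¹ = proj₁ (inv lc lc≢0)

  lc-cancels : ∀ a → lc * (a * lc⁻¹) ≡ a
  lc-cancels a = begin
    lc * (a * lc⁻¹) ≡⟨ cong (lc *_) (*-comm a lc⁻¹) ⟩
    lc * (lc⁻¹ * a) ≡⟨ sym (*-assoc lc lc⁻¹ a) ⟩
    (lc * lc⁻¹) * a ≡⟨ cong (_* a) (proj₂ (inv lc lc≢0)) ⟩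
    1# * a          ≡⟨ *-identityˡ a ⟩
    a               ∎

  digit⇒vanishes : ∀ b → size b < size P → VanishesFrom m b
  digit⇒vanishes b b<P = size⇒vanishes b (≤-pred (subst (size b <_) deg-P b<P))

  vanishes⇒digit : ∀ b → VanishesFrom m b → size b < size P
  vanishes⇒digit b vanish = subst (size b <_) (sym deg-P) (s≤s (vanishes⇒size b m vanish))

  multiple-vanishes⇒zero : ∀ d → VanishesFrom m (P *ₚ d) → d ≡ 0ₚ
  multiple-vanishes⇒zero ([] , _) _ = refl
  multiple-vanishes⇒zero d@(x ∷ xs , norm-d) vanish =
    ⊥-elim (no-zero-divisors lc≢0 (leading-nonzero (coeffs d) k norm-d refl) (begin
      lc * ⟦ d ⟧ k                              ≡⟨ sym (mul-top m k (coeffs P) (coeffs d) P-top d-top) ⟩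
      coeff (mulL (coeffs P) (coeffs d)) (m +ℕ k) ≡⟨ sym (⟦*⟧ P d (m +ℕ k)) ⟩
      ⟦ P *ₚ d ⟧ (m +ℕ k)                       ≡⟨ vanish (m +ℕ k) (m≤m+n m k) ⟩
      0#                                        ∎))
    where
    k = length xs
    P-top : ∀ i → m < i → ⟦ P ⟧ i ≡ 0#
    P-top i m<i = coeff-beyond (coeffs P) i (subst (_≤ i) (sym deg-P) m<i)
    d-top : ∀ j → k < j → ⟦ d ⟧ j ≡ 0#
    d-top j k<j = coeff-beyond (coeffs d) j k<j

  -- division with remainder is unique: P·(a − a') = b' − b has degree < m,
  -- so a = a', and then b = b'
  division-unique : ∀ a a' b b' → VanishesFrom m b → VanishesFrom m b' →
                    P *ₚ a +ₚ b ≡ P *ₚ a' +ₚ b' → a ≡ a' × b ≡ b'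
  division-unique a a' b b' b-small b'-small eq = a≡a' , b≡b'
    where
    -- above degree m only the multiples of P contribute
    high-equal : ∀ i → m ≤ i → ⟦ P *ₚ a ⟧ i ≡ ⟦ P *ₚ a' ⟧ i
    high-equal i m≤i = begin
      ⟦ P *ₚ a ⟧ i                  ≡⟨ sym (+-identityʳ _) ⟩
      ⟦ P *ₚ a ⟧ i + 0#             ≡⟨ cong (⟦ P *ₚ a ⟧ i +_) (sym (b-small i m≤i)) ⟩
      ⟦ P *ₚ a ⟧ i + ⟦ b ⟧ i        ≡⟨ sym (⟦+⟧ (P *ₚ a) b i) ⟩
      ⟦ P *ₚ a +ₚ b ⟧ i             ≡⟨ cong (λ r → ⟦ r ⟧ i) eq ⟩
      ⟦ P *ₚ a' +ₚ b' ⟧ i           ≡⟨ ⟦+⟧ (P *ₚ a') b' i ⟩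
      ⟦ P *ₚ a' ⟧ i + ⟦ b' ⟧ i      ≡⟨ cong (⟦ P *ₚ a' ⟧ i +_) (b'-small i m≤i) ⟩
      ⟦ P *ₚ a' ⟧ i + 0#            ≡⟨ +-identityʳ _ ⟩
      ⟦ P *ₚ a' ⟧ i                 ∎

    difference-vanishes : VanishesFrom m (P *ₚ (a +ₚ -ₚ a'))
    difference-vanishes i m≤i = begin
      ⟦ P *ₚ (a +ₚ -ₚ a') ⟧ i              ≡⟨ cong (λ r → ⟦ r ⟧ i) (x[y-z]≈xy-xz P a a') ⟩
      ⟦ P *ₚ a +ₚ -ₚ (P *ₚ a') ⟧ i         ≡⟨ ⟦+⟧ (P *ₚ a) (-ₚ (P *ₚ a')) i ⟩
      ⟦ P *ₚ a ⟧ i + ⟦ -ₚ (P *ₚ a') ⟧ i    ≡⟨ cong₂ _+_ (high-equal i m≤i) (⟦-⟧ (P *ₚ a') i) ⟩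
      ⟦ P *ₚ a' ⟧ i + - ⟦ P *ₚ a' ⟧ i      ≡⟨ -‿inverseʳ _ ⟩
      0#                                   ∎

    a≡a' : a ≡ a'
    a≡a' = x∙y⁻¹≈ε⇒x≈y a a' (multiple-vanishes⇒zero (a +ₚ -ₚ a') difference-vanishes)

    b≡b' : b ≡ b'
    b≡b' = +-cancelˡ (P *ₚ a) b b' (trans eq (cong (λ x → P *ₚ x +ₚ b') (sym a≡a')))

-- (4) Expansions and digit strings in base P/Q, for any P of degree m:
-- the expansion of a polynomial is unique, and ends in zero digits.
module Expansions (K : FiniteField) (P Q : PolyOver.Poly K) (m : ℕ) (deg-P : PolyOver.size K P ≡ suc m) where
  open PolyOver K
  open Base P Q
  open PolynomialRing K
  open Division K P m deg-P
  open CommutativeRing polyRing using () renaming (zeroʳ to *ₚ-zeroʳ; +-identityʳ to +ₚ-identityʳ)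
  open ≡-Reasoning

  zeroDigit : Digit
  zeroDigit = 0ₚ , subst (0 <_) (sym deg-P) (s≤s z≤n)

  -- a digit is determined by its polynomial (the degree bound is a proposition)
  digit-ext : ∀ {d d' : Digit} → proj₁ d ≡ proj₁ d' → d ≡ d'
  digit-ext {s , s<P} {.s , s<P'} refl = cong (s ,_) (≤-irrelevant s<P s<P')

  step-unique : ∀ v v₁ v₁' d d' → Q *ₚ v ≡ P *ₚ v₁ +ₚ proj₁ d → Q *ₚ v ≡ P *ₚ v₁' +ₚ proj₁ d' →
                v₁ ≡ v₁' × d ≡ d'
  step-unique v v₁ v₁' d d' eq eq' with division-unique v₁ v₁' (proj₁ d) (proj₁ d')
    (digit⇒vanishes (proj₁ d) (proj₂ d)) (digit⇒vanishes (proj₁ d') (proj₂ d')) (trans (sym eq) eq')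
  ... | v₁≡v₁' , d≡d' = v₁≡v₁' , digit-ext d≡d'

  states-unique : ∀ {w} ws s ws' s' → IsExpansion w ws s → IsExpansion w ws' s' → ∀ i → ws i ≡ ws' i
  states-unique ws s ws' s' (ws₀ , _) (ws₀' , _) zero = trans ws₀ (sym ws₀')
  states-unique ws s ws' s' e@(_ , rec) e'@(_ , rec') (suc i) =
    proj₁ (step-unique (ws i) (ws (suc i)) (ws' (suc i)) (s i) (s' i)
      (rec i) (trans (cong (Q *ₚ_) (states-unique ws s ws' s' e e' i)) (rec' i)))

  digits-unique : ∀ {w} ws s ws' s' → IsExpansion w ws s → IsExpansion w ws' s' → ∀ i → s i ≡ s' i
  digits-unique ws s ws' s' e@(_ , rec) e'@(_ , rec') i =
    proj₂ (step-unique (ws i) (ws (suc i)) (ws' (suc i)) (s i) (s' i)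
      (rec i) (trans (cong (Q *ₚ_) (states-unique ws s ws' s' e e' i)) (rec' i)))

  trailing-digits-zero : ∀ {w} ws s k → IsExpansion w ws s → (∀ i → k < i → ws i ≡ 0ₚ) →
                         ∀ i → k < i → s i ≡ zeroDigit
  trailing-digits-zero ws s k (_ , rec) vanish i k<i =
    proj₂ (step-unique 0ₚ 0ₚ 0ₚ (s i) zeroDigit zero-step zero-step')
    where
    zero-step : Q *ₚ 0ₚ ≡ P *ₚ 0ₚ +ₚ proj₁ (s i)
    zero-step = trans (cong (Q *ₚ_) (sym (vanish i k<i)))
      (trans (rec i) (cong (λ v → P *ₚ v +ₚ proj₁ (s i)) (vanish (suc i) (≤-trans k<i (n≤1+n i)))))
    zero-step' : Q *ₚ 0ₚ ≡ P *ₚ 0ₚ +ₚ proj₁ zeroDigit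
    zero-step' = trans (*ₚ-zeroʳ Q) (sym (trans (+ₚ-identityʳ (P *ₚ 0ₚ)) (*ₚ-zeroʳ P)))

  digitWord-downFrom : ∀ t k → digitWord t k ≡ map t (downFrom (suc k))
  digitWord-downFrom t k = cong (map t) (reverse-upTo (suc k))

  digitWord-suc : ∀ t k → digitWord t (suc k) ≡ t (suc k) ∷ digitWord t k
  digitWord-suc t k = trans (digitWord-downFrom t (suc k)) (cong (t (suc k) ∷_) (sym (digitWord-downFrom t k)))

  -- reversed, sₖ ⋯ s₀ is the input order s₀, …, sₖ of a transducer
  reverse-digitWord : ∀ t k → reverse (digitWord t k) ≡ applyUpTo t (suc k)
  reverse-digitWord t k = begin
    reverse (map t (reverse (upTo (suc k)))) ≡⟨ sym (reverse-map t (reverse (upTo (suc k)))) ⟩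
    map t (reverse (reverse (upTo (suc k)))) ≡⟨ cong (map t) (reverse-involutive (upTo (suc k))) ⟩
    map t (upTo (suc k))                     ≡⟨ map-upTo t (suc k) ⟩
    applyUpTo t (suc k)                      ∎

  strip-padding : ∀ t a b → b ≤ a → (∀ i → b < i → t i ≡ zeroDigit) →
                  stripLeadingZeros (digitWord t a) ≡ stripLeadingZeros (digitWord t b)
  strip-padding t zero    .zero z≤n _ = refl
  strip-padding t (suc a) b b≤1+a zeros with m≤n⇒m<n∨m≡n b≤1+a
  ... | inj₂ refl = refl
  ... | inj₁ b<1+a = begin
    stripLeadingZeros (digitWord t (suc a))      ≡⟨ cong stripLeadingZeros (digitWord-suc t a) ⟩
    stripLeadingZeros (t (suc a) ∷ digitWord t a) ≡⟨ cong (λ d → stripLeadingZeros (d ∷ digitWord t a))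
                                                         (zeros (suc a) b<1+a) ⟩
    stripLeadingZeros (digitWord t a)            ≡⟨ strip-padding t a b (≤-pred b<1+a) zeros ⟩
    stripLeadingZeros (digitWord t b)            ∎

-- (5)–(6) The carry transducer for P, Q with deg P = m > deg Q.
module CarryTransducer (K : FiniteField) (P Q : PolyOver.Poly K) (m : ℕ)
                       (deg-P : PolyOver.size K P ≡ suc m) (Q<P : PolyOver.size K Q < PolyOver.size K P) where
  open FiniteField K using (F; 0#; q; enum)
  open PolyOver K
  open Base P Q
  open CoefficientCalculus K
  open PolynomialRing K
  open Degrees K
  open Division K P m deg-P
  open Expansions K P Q m deg-P
  open CommutativeRing (fieldRing K)
    using (_+_; _*_; -_; +-identityˡ; zeroˡ; -‿inverseʳ)
  open CommutativeRing polyRing using (commutativeSemiring)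
    renaming (zeroʳ to *ₚ-zeroʳ; +-identityʳ to +ₚ-identityʳ)
  open import Algebra.Properties.Ring (CommutativeRing.ring polyRing) using (//-rightDividesˡ)
  open import Algebra.Solver.Ring.NaturalCoefficients.Default commutativeSemiring
    using (solve; _:=_; _:+_; _:*_)
  open ≡-Reasoning

  -- (5) One carry step.  For a carry c and a digit d, X·d + Q·c has degree
  -- ≤ m, so its quotient by P is the constant nextCarry c d.
  carryInput : F → Digit → Poly
  carryInput c d = Xₚ *ₚ proj₁ d +ₚ Q *ₚ Cₚ c

  carryInput-vanishes : ∀ c d → VanishesFrom (suc m) (carryInput c d)
  carryInput-vanishes c (s , s<P) (suc i) (s≤s m≤i) = begin
    ⟦ Xₚ *ₚ s +ₚ Q *ₚ Cₚ c ⟧ (suc i)          ≡⟨ ⟦+⟧ (Xₚ *ₚ s) (Q *ₚ Cₚ c) (suc i) ⟩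
    ⟦ Xₚ *ₚ s ⟧ (suc i) + ⟦ Q *ₚ Cₚ c ⟧ (suc i) ≡⟨ cong₂ _+_ (⟦X*⟧ s i) (⟦*C⟧ Q c (suc i)) ⟩
    ⟦ s ⟧ i + ⟦ Q ⟧ (suc i) * c               ≡⟨ cong₂ (λ x y → x + y * c) (digit⇒vanishes s s<P i m≤i)
                                                    (digit⇒vanishes Q Q<P (suc i) (≤-trans m≤i (n≤1+n i))) ⟩
    0# + 0# * c                               ≡⟨ +-identityˡ _ ⟩
    0# * c                                    ≡⟨ zeroˡ c ⟩
    0#                                        ∎

  -- the quotient: top coefficient of X·d + Q·c over the leading coefficient of P
  nextCarry : F → Digit → F
  nextCarry c d = ⟦ carryInput c d ⟧ m * lc⁻¹

  carryRemainder : F → Digit → Poly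
  carryRemainder c d = carryInput c d +ₚ -ₚ (P *ₚ Cₚ (nextCarry c d))

  remainder-vanishes : ∀ c d → VanishesFrom m (carryRemainder c d)
  remainder-vanishes c d i m≤i = begin
    ⟦ carryRemainder c d ⟧ i                             ≡⟨ ⟦+⟧ (carryInput c d) (-ₚ (P *ₚ Cₚ c')) i ⟩
    ⟦ carryInput c d ⟧ i + ⟦ -ₚ (P *ₚ Cₚ c') ⟧ i         ≡⟨ cong (⟦ carryInput c d ⟧ i +_)
                                                              (trans (⟦-⟧ (P *ₚ Cₚ c') i) (cong -_ (⟦*C⟧ P c' i))) ⟩
    ⟦ carryInput c d ⟧ i + - (⟦ P ⟧ i * c')              ≡⟨ top-cancels i (m≤n⇒m<n∨m≡n m≤i) ⟩
    0#                                                   ∎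
    where
    c' = nextCarry c d
    -- at index m the leading terms cancel; above it both terms vanish
    top-cancels : ∀ i → m < i ⊎ m ≡ i → ⟦ carryInput c d ⟧ i + - (⟦ P ⟧ i * c') ≡ 0#
    top-cancels i (inj₁ m<i) = begin
      ⟦ carryInput c d ⟧ i + - (⟦ P ⟧ i * c') ≡⟨ cong₂ (λ x y → x + - (y * c')) (carryInput-vanishes c d i m<i)
                                                   (coeff-beyond (coeffs P) i (subst (_≤ i) (sym deg-P) m<i)) ⟩
      0# + - (0# * c')                        ≡⟨ cong (λ x → 0# + - x) (zeroˡ c') ⟩
      0# + - 0#                               ≡⟨ -‿inverseʳ 0# ⟩
      0#                                      ∎
    top-cancels .m (inj₂ refl) = begin
      a + - (lc * (a * lc⁻¹))                 ≡⟨ cong (λ x → a + - x) (lc-cancels a) ⟩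
      a + - a                                 ≡⟨ -‿inverseʳ a ⟩
      0#                                      ∎
      where
      a = ⟦ carryInput c d ⟧ m

  carryDigit : F → Digit → Digit
  carryDigit c d = carryRemainder c d , vanishes⇒digit (carryRemainder c d) (remainder-vanishes c d)

  carry-division : ∀ c d → carryInput c d ≡ P *ₚ Cₚ (nextCarry c d) +ₚ proj₁ (carryDigit c d)
  carry-division c d = trans (sym (//-rightDividesˡ (P *ₚ Cₚ (nextCarry c d)) (carryInput c d)))
                             (+ₚ-comm (carryRemainder c d) (P *ₚ Cₚ (nextCarry c d)))

  carry-step : ∀ w w' c d → Q *ₚ w ≡ P *ₚ w' +ₚ proj₁ d →
    Q *ₚ (Xₚ *ₚ w +ₚ Cₚ c) ≡ P *ₚ (Xₚ *ₚ w' +ₚ Cₚ (nextCarry c d)) +ₚ proj₁ (carryDigit c d)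
  carry-step w w' c d step = begin
    Q *ₚ (Xₚ *ₚ w +ₚ Cₚ c)                              ≡⟨ expand Q Xₚ w (Cₚ c) ⟩
    Xₚ *ₚ (Q *ₚ w) +ₚ Q *ₚ Cₚ c                         ≡⟨ cong (λ v → Xₚ *ₚ v +ₚ Q *ₚ Cₚ c) step ⟩
    Xₚ *ₚ (P *ₚ w' +ₚ s) +ₚ Q *ₚ Cₚ c                   ≡⟨ regroup Xₚ P w' s (Q *ₚ Cₚ c) ⟩
    P *ₚ (Xₚ *ₚ w') +ₚ carryInput c d                   ≡⟨ cong (P *ₚ (Xₚ *ₚ w') +ₚ_) (carry-division c d) ⟩
    P *ₚ (Xₚ *ₚ w') +ₚ (P *ₚ Cₚ c' +ₚ t)                ≡⟨ collect P (Xₚ *ₚ w') (Cₚ c') t ⟩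
    P *ₚ (Xₚ *ₚ w' +ₚ Cₚ c') +ₚ t                       ∎
    where
    s = proj₁ d
    c' = nextCarry c d
    t = proj₁ (carryDigit c d)
    expand : ∀ q x w r → q *ₚ (x *ₚ w +ₚ r) ≡ x *ₚ (q *ₚ w) +ₚ q *ₚ r
    expand = solve 4 (λ q x w r → q :* (x :* w :+ r) := x :* (q :* w) :+ q :* r) refl
    regroup : ∀ x p w s r → x *ₚ (p *ₚ w +ₚ s) +ₚ r ≡ p *ₚ (x *ₚ w) +ₚ (x *ₚ s +ₚ r)
    regroup = solve 5 (λ x p w s r → x :* (p :* w :+ s) :+ r := p :* (x :* w) :+ (x :* s :+ r)) refl
    collect : ∀ p u v t → p *ₚ u +ₚ (p *ₚ v +ₚ t) ≡ p *ₚ (u +ₚ v) +ₚ t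
    collect = solve 4 (λ p u v t → p :* u :+ (p :* v :+ t) := p :* (u :+ v) :+ t) refl

  -- reading a zero digit produces no new carry, since deg Q < deg P
  nextCarry-zero : ∀ c → nextCarry c zeroDigit ≡ 0#
  nextCarry-zero c = begin
    ⟦ Xₚ *ₚ 0ₚ +ₚ Q *ₚ Cₚ c ⟧ m * lc⁻¹              ≡⟨ cong (_* lc⁻¹) (⟦+⟧ (Xₚ *ₚ 0ₚ) (Q *ₚ Cₚ c) m) ⟩
    (⟦ Xₚ *ₚ 0ₚ ⟧ m + ⟦ Q *ₚ Cₚ c ⟧ m) * lc⁻¹        ≡⟨ cong₂ (λ x y → (x + y) * lc⁻¹)
                                                          (cong (λ p → ⟦ p ⟧ m) (*ₚ-zeroʳ Xₚ)) (⟦*C⟧ Q c m) ⟩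
    (0# + ⟦ Q ⟧ m * c) * lc⁻¹                       ≡⟨ cong (λ x → (0# + x * c) * lc⁻¹)
                                                          (digit⇒vanishes Q Q<P m ≤-refl) ⟩
    (0# + 0# * c) * lc⁻¹                            ≡⟨ cong (_* lc⁻¹) (trans (+-identityˡ _) (zeroˡ c)) ⟩
    0# * lc⁻¹                                       ≡⟨ zeroˡ lc⁻¹ ⟩
    0#                                              ∎

  -- (6) The transducer.  Its states are the carries, identified with Fin q
  -- through the enumeration of 𝔽_q; it starts with carry 0, and at the end
  -- emits the digit produced by reading one more zero digit.
  encode : F → Fin q
  encode = Inverse.from enum

  decode : Fin q → F
  decode = Inverse.to enum

  decode-encode : ∀ c → decode (encode c) ≡ c
  decode-encode = Inverse.strictlyInverseˡ enum

  carryTransducer : Transducer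
  carryTransducer = record
    { n      = q
    ; u₀     = encode 0#
    ; step   = λ u d → encode (nextCarry (decode u) d)
    ; result = λ u d → carryDigit (decode u) d
    ; final  = λ u → carryDigit (decode u) zeroDigit
    }

  open Transducer carryTransducer using (runRev; output; step; result)

  -- the carries c₀ = c, cᵢ₊₁ = nextCarry cᵢ sᵢ along a digit sequence s
  -- (defined by shifting s, which is how the transducer consumes it)
  carries : F → (ℕ → Digit) → ℕ → F
  carries c s zero    = c
  carries c s (suc i) = carries (nextCarry c (s 0)) (s ∘ suc) i

  carries-suc : ∀ c s i → carries c s (suc i) ≡ nextCarry (carries c s i) (s i)
  carries-suc c s zero    = refl
  carries-suc c s (suc i) = carries-suc (nextCarry c (s 0)) (s ∘ suc) i

  outputs : F → (ℕ → Digit) → ℕ → Digit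
  outputs c s i = carryDigit (carries c s i) (s i)

  -- unfolding runRev and output, which are defined by with-abstraction
  runRev-cons : ∀ u x xs {u' ds} → runRev (step u x) xs ≡ (u' , ds) → runRev u (x ∷ xs) ≡ (u' , result u x ∷ ds)
  runRev-cons u x xs eq with runRev (step u x) xs | eq
  ... | _ | refl = refl

  run-carries : ∀ c s n → runRev (encode c) (applyUpTo s n) ≡ (encode (carries c s n) , applyUpTo (outputs c s) n)
  run-carries c s zero    = refl
  run-carries c s (suc n) = trans
    (runRev-cons (encode c) (s 0) (applyUpTo (s ∘ suc) n)
      (trans (cong (λ c₀ → runRev (encode (nextCarry c₀ (s 0))) (applyUpTo (s ∘ suc) n)) (decode-encode c))
             (run-carries (nextCarry c (s 0)) (s ∘ suc) n)))
    (cong (λ c₀ → encode (carries c s (suc n)) , carryDigit c₀ (s 0) ∷ applyUpTo (outputs c s ∘ suc) n)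
          (decode-encode c))

  output-eq : ∀ word {u ds} → runRev (encode 0#) (reverse word) ≡ (u , ds) →
              output word ≡ carryDigit (decode u) zeroDigit ∷ reverse ds
  output-eq word eq with runRev (encode 0#) (reverse word) | eq
  ... | _ | refl = refl

  output-digitWord : ∀ s k → s (suc k) ≡ zeroDigit → output (digitWord s k) ≡ digitWord (outputs 0# s) (suc k)
  output-digitWord s k s₁₊ₖ≡0 = begin
    output (digitWord s k)
      ≡⟨ output-eq (digitWord s k) run ⟩
    carryDigit (decode (encode (carries 0# s (suc k)))) zeroDigit ∷ reverse (applyUpTo t (suc k))
      ≡⟨ cong₂ _∷_ (cong₂ carryDigit (decode-encode (carries 0# s (suc k))) (sym s₁₊ₖ≡0))
                   (trans (cong reverse (sym (map-upTo t (suc k)))) (sym (reverse-map t (upTo (suc k))))) ⟩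
    t (suc k) ∷ digitWord t k
      ≡⟨ sym (digitWord-suc t k) ⟩
    digitWord t (suc k) ∎
    where
    t = outputs 0# s
    run : runRev (encode 0#) (reverse (digitWord s k)) ≡ (encode (carries 0# s (suc k)) , applyUpTo t (suc k))
    run = trans (cong (runRev (encode 0#)) (reverse-digitWord s k)) (run-carries 0# s (suc k))

  carryStates : (ℕ → Poly) → (ℕ → Digit) → ℕ → Poly
  carryStates ws s i = Xₚ *ₚ ws i +ₚ Cₚ (carries 0# s i)

  carry-expansion : ∀ w ws s → IsExpansion w ws s → IsExpansion (Xₚ *ₚ w) (carryStates ws s) (outputs 0# s)
  carry-expansion w ws s (ws₀ , rec) = start , step-i
    where
    step-i : ∀ i → Q *ₚ carryStates ws s i ≡ P *ₚ carryStates ws s (suc i) +ₚ proj₁ (outputs 0# s i)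
    step-i i = trans (carry-step (ws i) (ws (suc i)) (carries 0# s i) (s i) (rec i))
      (cong (λ c → P *ₚ (Xₚ *ₚ ws (suc i) +ₚ Cₚ c) +ₚ proj₁ (outputs 0# s i)) (sym (carries-suc 0# s i)))
    start : Xₚ *ₚ ws 0 +ₚ Cₚ 0# ≡ Xₚ *ₚ w
    start = trans (cong₂ (λ v c → Xₚ *ₚ v +ₚ c) ws₀ Cₚ-zero) (+ₚ-identityʳ (Xₚ *ₚ w))

  carryStates-vanish : ∀ {w} ws s k → IsExpansion w ws s → (∀ i → k < i → ws i ≡ 0ₚ) →
                       ∀ i → suc k < i → carryStates ws s i ≡ 0ₚ
  carryStates-vanish ws s k e vanish (suc i) (s≤s k<i) = begin
    Xₚ *ₚ ws (suc i) +ₚ Cₚ (carries 0# s (suc i))           ≡⟨ cong₂ (λ v c → Xₚ *ₚ v +ₚ Cₚ c)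
                                                                 (vanish (suc i) (≤-trans k<i (n≤1+n i))) no-carry ⟩
    Xₚ *ₚ 0ₚ +ₚ Cₚ 0#                                       ≡⟨ cong₂ _+ₚ_ (*ₚ-zeroʳ Xₚ) Cₚ-zero ⟩
    0ₚ +ₚ 0ₚ                                                ≡⟨ +ₚ-identityʳ 0ₚ ⟩
    0ₚ                                                      ∎
    where
    no-carry : carries 0# s (suc i) ≡ 0#
    no-carry = trans (carries-suc 0# s i)
      (trans (cong (nextCarry (carries 0# s i)) (trailing-digits-zero ws s k e vanish i k<i)) (nextCarry-zero _))

  -- On ⟨w⟩ = sₖ ⋯ s₀ the transducer prints tₖ₊₁ ⋯ t₀, the digits of the
  -- carry expansion of X·w; by uniqueness these are the digits of ⟨X·w⟩,
  -- which has k' + 1 ≤ k + 2 digits, the others being leading zeros.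
  realizes : Realizes carryTransducer
  realizes w _ _ (ws , s , k , e , (vanish , _) , refl) (ws' , s' , k' , e' , (vanish' , minimal') , refl) = begin
    stripLeadingZeros (output (digitWord s k))
      ≡⟨ cong stripLeadingZeros (output-digitWord s k s₁₊ₖ≡0) ⟩
    stripLeadingZeros (digitWord t (suc k))
      ≡⟨ strip-padding t (suc k) k' k'≤1+k t-zero ⟩
    stripLeadingZeros (digitWord t k')
      ≡⟨ cong stripLeadingZeros (map-cong (digits-unique V t ws' s' eX e') (reverse (upTo (suc k')))) ⟩
    stripLeadingZeros (digitWord s' k') ∎
    where
    s₁₊ₖ≡0 = trailing-digits-zero ws s k e vanish (suc k) ≤-refl
    t = outputs 0# s
    V = carryStates ws s
    eX = carry-expansion w ws s e
    k'≤1+k : k' ≤ suc k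
    k'≤1+k = minimal' (suc k) λ i 1+k<i →
      trans (sym (states-unique V t ws' s' eX e' i)) (carryStates-vanish ws s k e vanish i 1+k<i)
    t-zero : ∀ i → k' < i → t i ≡ zeroDigit
    t-zero i k'<i =
      trans (digits-unique V t ws' s' eX e' i) (trailing-digits-zero ws' s' k' e' vanish' i k'<i)

size-positive : ∀ {a b} → a < b → Σ ℕ (λ m → b ≡ suc m)
size-positive {b = suc m} _ = m , refl

theorem3p9 : (K : FiniteField) → let open PolyOver K in
    (P Q : Poly) → P ≢ 0ₚ → Q ≢ 0ₚ → Coprime P Q → size Q < size P →
    Σ (Base.Transducer P Q) (Base.Realizes P Q)
theorem3p9 K P Q _ _ _ Q<P with size-positive Q<P
... | m , deg-P = Carry.carryTransducer , Carry.realizes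
  where module Carry = CarryTransducer K P Q m deg-P Q<P
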